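{- For $k\geq 4$, define integers $t_k(n)$ by \[\sum_{n\geq 0}t_k(n)q^n=\sum_{j=2}^{k}\frac{q^{2j}(1-q^{k-j+2})}{(q^2;q)_{j-1}}.\] Then $t_k(n)\geq 0$ for all $n\geq 0$. Moreover, when $k\neq 5$, $t_k(n)\geq 1$ for all $n\geq 14$.
   Context: $(a;q)_j=\prod_{i=0}^{j-1}(1-aq^i)$, with $(a;q)_0=1$. -}

module Defs where

open import Data.Nat as ℕ using (ℕ; zero; suc; _∸_)
open import Data.Nat.Divisibility using (_∣?_)
open import Data.Integer using (ℤ; 0ℤ; 1ℤ; _+_; _-_; _*_)
open import Data.List using (List; map; upTo; foldr)
open import Data.Bool using (if_then_else_)
open import Relation.Nullary using (does)

sumℤ : List ℤ → ℤ
sumℤ = foldr _+_ 0ℤ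

-- Formal power series in q with integer coefficients: n ↦ coefficient of q^n.
Series : Set
Series = ℕ → ℤ

_⊛_ : Series → Series → Series
(f ⊛ g) n = sumℤ (map (λ i → f i * g (n ∸ i)) (upTo (suc n)))

_⊕_ : Series → Series → Series
(f ⊕ g) n = f n + g n

_⊖_ : Series → Series → Series
(f ⊖ g) n = f n - g n

mono : ℕ → Series
mono a n = if does (a ℕ.≟ n) then 1ℤ else 0ℤ

one : Series
one = mono 0

-- geometric series 1/(1 - q^m) = Σ_{r ≥ 0} q^{m r}   (used only for m ≥ 2)
geom : ℕ → Series
geom m n = if does (m ∣? n) then 1ℤ else 0ℤ

-- 1/(q^2;q)_m = ∏_{i=0}^{m-1} 1/(1 - q^{2+i})
invPoch2 : ℕ → Series
invPoch2 zero    = one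
invPoch2 (suc m) = invPoch2 m ⊛ geom (2 ℕ.+ m)

summand : ℕ → ℕ → Series
summand k j = (mono (2 ℕ.* j) ⊖ mono (2 ℕ.* j ℕ.+ (k ∸ j ℕ.+ 2))) ⊛ invPoch2 (j ∸ 1)

t : ℕ → ℕ → ℤ
t k n = sumℤ (map (λ i → summand k (2 ℕ.+ i) n) (upTo (k ∸ 1)))

-- Write Q m = 1/(q²;q)_m; the j-th summand is q^(2j) (Q (j−1) − q^c Q (j−1)) with c = k − j + 2.
-- The coefficient of q^n in Q m counts partitions of n into parts 2, …, m + 1, so for d ≤ m + 1
-- the difference Q m (n) − Q m (n − d) counts those without a part d, among them all partitions
-- with parts below d. Hence for m ≥ 2 the coefficients never decrease along a step c ≠ 1, and
-- every summand with j ≥ 3 is non-negative; with d = 4 the summands j = 4, 5 are at least 1 for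
-- moderately large n as long as their step is 4 or at least 6. The summand j = 2 is
-- q⁴ (1 − q^k)/(1 − q²), with coefficients in {−1, 0, 1}, non-negative when k is even or
-- n < k + 4, so for k ≥ 9 the two positive summands outweigh it. The steps 2 (k = 4, 5) and
-- 5 (k = 7) are handled by counting partitions into parts 3, 4 (and 5), and the remaining
-- small n by evaluation.
module Submission where

open import Defs
open import Data.Nat using (ℕ; _≤_)
open import Data.Integer using (0ℤ; 1ℤ) renaming (_≤_ to _≤ℤ_)
open import Data.Product using (_×_)
open import Relation.Binary.PropositionalEquality using (_≢_)

open import Data.Bool using (true; false; if_then_else_)
open import Data.Fin using (toℕ; fromℕ<)
open import Data.Fin.Properties using (all?; toℕ-fromℕ<)
open import Data.Integer using (ℤ; -1ℤ; _+_; _-_; _*_; -_; +≤+; -≤+; nonNegative; _≤?_)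
import Data.Integer.Properties as ℤ
open import Data.Integer.Tactic.RingSolver using (solve-∀)
open import Data.List using (map; applyUpTo)
open import Data.Nat as ℕ using (zero; suc; _∸_; _<_; _<?_; z≤n; s≤s; z<s; s<s)
import Data.Nat.Properties as ℕ
open import Algebra.Properties.CommutativeSemigroup ℕ.+-commutativeSemigroup
  using () renaming (x∙yz≈y∙xz to +-left-comm)
open import Data.Nat.Divisibility using (_∣?_; ∣-refl; ∣m+n∣m⇒∣n; ∣m∣n⇒∣m+n; >⇒∤)
open import Data.Nat.Induction using (<-rec)
open import Data.Product using (_,_; ∃-syntax)
open import Data.Sum using (_⊎_; inj₁; inj₂)
open import Data.Unit using (tt)
open import Function using (_∘_)
open import Function.Bundles using (mk⇔)
open import Relation.Binary.PropositionalEquality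
  using (_≡_; refl; sym; trans; cong; cong₂; subst; _≗_; module ≡-Reasoning)
open import Relation.Nullary using (contradiction; yes; no)
open import Relation.Nullary.Decidable using (True; does; dec-false; does-⇔; toWitness)
open import Relation.Unary using (Decidable)

sumBelow : (ℕ → ℤ) → ℕ → ℤ
sumBelow g zero    = 0ℤ
sumBelow g (suc n) = g 0 + sumBelow (g ∘ suc) n

infix 6.5 sumBelow
syntax sumBelow (λ i → e) n = ∑[ i < n ] e

sumℤ-map-applyUpTo : ∀ (g : ℕ → ℤ) f n → sumℤ (map g (applyUpTo f n)) ≡ ∑[ i < n ] g (f i)
sumℤ-map-applyUpTo g f zero    = refl
sumℤ-map-applyUpTo g f (suc n) = cong (g (f 0) +_) (sumℤ-map-applyUpTo g (f ∘ suc) n)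

∑-cong : ∀ {g h : ℕ → ℤ} n → (∀ {i} → i < n → g i ≡ h i) → ∑[ i < n ] g i ≡ ∑[ i < n ] h i
∑-cong zero    eq = refl
∑-cong (suc n) eq = cong₂ _+_ (eq z<s) (∑-cong n (eq ∘ s<s))

∑-zero : ∀ {g : ℕ → ℤ} n → (∀ i → g i ≡ 0ℤ) → ∑[ i < n ] g i ≡ 0ℤ
∑-zero zero    eq = refl
∑-zero (suc n) eq = cong₂ _+_ (eq 0) (∑-zero n (eq ∘ suc))

∑-suc : ∀ (g : ℕ → ℤ) n → ∑[ i < suc n ] g i ≡ ∑[ i < n ] g i + g n
∑-suc g zero    = trans (ℤ.+-identityʳ (g 0)) (sym (ℤ.+-identityˡ (g 0)))
∑-suc g (suc n) = trans (cong (g 0 +_) (∑-suc (g ∘ suc) n)) (sym (ℤ.+-assoc (g 0) _ _))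

∑-reverse : ∀ (g : ℕ → ℤ) n → ∑[ i < suc n ] g i ≡ ∑[ i < suc n ] g (n ∸ i)
∑-reverse g zero    = refl
∑-reverse g (suc n) = begin
  g 0 + ∑[ i < suc n ] g (suc i)             ≡⟨ cong (g 0 +_) (∑-reverse (g ∘ suc) n) ⟩
  g 0 + ∑[ i < suc n ] g (suc (n ∸ i))       ≡⟨ ℤ.+-comm (g 0) _ ⟩
  ∑[ i < suc n ] g (suc (n ∸ i)) + g 0       ≡⟨ cong₂ _+_ (∑-cong (suc n) λ i≤n → cong g (sym (ℕ.+-∸-assoc 1 (ℕ.≤-pred i≤n))))
                                                           (cong g (sym (ℕ.n∸n≡0 n))) ⟩
  ∑[ i < suc n ] g (suc n ∸ i) + g (suc n ∸ suc n) ≡⟨ sym (∑-suc (λ i → g (suc n ∸ i)) (suc n)) ⟩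
  ∑[ i < suc (suc n) ] g (suc n ∸ i)         ∎
  where open ≡-Reasoning

∑-distrib-+ : ∀ (g h : ℕ → ℤ) n → ∑[ i < n ] (g i + h i) ≡ ∑[ i < n ] g i + ∑[ i < n ] h i
∑-distrib-+ g h zero    = refl
∑-distrib-+ g h (suc n) =
  trans (cong (g 0 + h 0 +_) (∑-distrib-+ (g ∘ suc) (h ∘ suc) n)) (interchange (g 0) (h 0) _ _)
  where
  interchange : ∀ a b c d → (a + b) + (c + d) ≡ (a + c) + (b + d)
  interchange = solve-∀

∑-distrib-- : ∀ (g h : ℕ → ℤ) n → ∑[ i < n ] (g i - h i) ≡ ∑[ i < n ] g i - ∑[ i < n ] h i
∑-distrib-- g h zero    = refl
∑-distrib-- g h (suc n) =
  trans (cong (g 0 - h 0 +_) (∑-distrib-- (g ∘ suc) (h ∘ suc) n)) (interchange (g 0) (h 0) _ _)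
  where
  interchange : ∀ a b c d → (a - b) + (c - d) ≡ (a + c) - (b + d)
  interchange = solve-∀

∑-nonneg : ∀ {g : ℕ → ℤ} n → (∀ i → 0ℤ ≤ℤ g i) → 0ℤ ≤ℤ ∑[ i < n ] g i
∑-nonneg zero    g≥0 = ℤ.≤-refl
∑-nonneg (suc n) g≥0 = ℤ.+-mono-≤ (g≥0 0) (∑-nonneg n (g≥0 ∘ suc))

i+j≤k⇒i≤k-j : ∀ {i j k} → i + j ≤ℤ k → i ≤ℤ k - j
i+j≤k⇒i≤k-j {i} {j} {k} i+j≤k = subst (_≤ℤ k - j) (cancel i j) (ℤ.+-monoˡ-≤ (- j) i+j≤k)
  where
  cancel : ∀ i j → i + j - j ≡ i
  cancel = solve-∀

NonNeg : Series → Set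
NonNeg f = ∀ n → 0ℤ ≤ℤ f n

shift : ℕ → Series → Series
shift zero    f n       = f n
shift (suc a) f zero    = 0ℤ
shift (suc a) f (suc n) = shift a f n

below-or-above : ∀ c n → n < c ⊎ ∃[ y ] n ≡ c ℕ.+ y
below-or-above zero    n       = inj₂ (n , refl)
below-or-above (suc c) zero    = inj₁ z<s
below-or-above (suc c) (suc n) with below-or-above c n
... | inj₁ n<c        = inj₁ (s<s n<c)
... | inj₂ (y , n≡c+y) = inj₂ (y , cong suc n≡c+y)

shift-below : ∀ a f {n} → n < a → shift a f n ≡ 0ℤ
shift-below (suc a) f {zero}  _         = refl
shift-below (suc a) f {suc n} (s<s n<a) = shift-below a f n<a

shift-above : ∀ a f y → shift a f (a ℕ.+ y) ≡ f y
shift-above zero    f y = refl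
shift-above (suc a) f y = shift-above a f y

shift-elim : ∀ (P : ℤ → Set) a f → P 0ℤ → (∀ y → P (f y)) → ∀ n → P (shift a f n)
shift-elim P zero    f P0 Pf n       = Pf n
shift-elim P (suc a) f P0 Pf zero    = P0
shift-elim P (suc a) f P0 Pf (suc n) = shift-elim P a f P0 Pf n

shift-nonneg : ∀ a {f} → NonNeg f → NonNeg (shift a f)
shift-nonneg a {f} = shift-elim (0ℤ ≤ℤ_) a f ℤ.≤-refl

shift-cong : ∀ a {f g} → f ≗ g → shift a f ≗ shift a g
shift-cong zero    f≗g n       = f≗g n
shift-cong (suc a) f≗g zero    = refl
shift-cong (suc a) f≗g (suc n) = shift-cong a f≗g n

shift-+ : ∀ a c f → shift (a ℕ.+ c) f ≗ shift a (shift c f)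
shift-+ zero    c f n       = refl
shift-+ (suc a) c f zero    = refl
shift-+ (suc a) c f (suc n) = shift-+ a c f n

shift-⊖ : ∀ a f g → shift a f ⊖ shift a g ≗ shift a (f ⊖ g)
shift-⊖ zero    f g n       = refl
shift-⊖ (suc a) f g zero    = refl
shift-⊖ (suc a) f g (suc n) = shift-⊖ a f g n

⊛-as-sum : ∀ f g n → (f ⊛ g) n ≡ ∑[ i < suc n ] f i * g (n ∸ i)
⊛-as-sum f g n = sumℤ-map-applyUpTo (λ i → f i * g (n ∸ i)) (λ i → i) (suc n)

⊛-comm : ∀ f g → f ⊛ g ≗ g ⊛ f
⊛-comm f g n = begin
  (f ⊛ g) n                                 ≡⟨ ⊛-as-sum f g n ⟩
  ∑[ i < suc n ] f i * g (n ∸ i)            ≡⟨ ∑-reverse (λ i → f i * g (n ∸ i)) n ⟩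
  ∑[ i < suc n ] f (n ∸ i) * g (n ∸ (n ∸ i)) ≡⟨ ∑-cong (suc n) swap ⟩
  ∑[ i < suc n ] g i * f (n ∸ i)            ≡⟨ ⊛-as-sum g f n ⟨
  (g ⊛ f) n                                 ∎
  where
  open ≡-Reasoning
  swap : ∀ {i} → i < suc n → f (n ∸ i) * g (n ∸ (n ∸ i)) ≡ g i * f (n ∸ i)
  swap {i} i≤n = trans (cong (λ j → f (n ∸ i) * g j) (ℕ.m∸[m∸n]≡n (ℕ.≤-pred i≤n))) (ℤ.*-comm (f (n ∸ i)) (g i))

⊛-congˡ : ∀ {f f′} g → f ≗ f′ → f ⊛ g ≗ f′ ⊛ g
⊛-congˡ {f} {f′} g f≗f′ n = begin
  (f ⊛ g) n                       ≡⟨ ⊛-as-sum f g n ⟩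
  ∑[ i < suc n ] f i * g (n ∸ i)  ≡⟨ ∑-cong (suc n) (λ {i} _ → cong (_* g (n ∸ i)) (f≗f′ i)) ⟩
  ∑[ i < suc n ] f′ i * g (n ∸ i) ≡⟨ ⊛-as-sum f′ g n ⟨
  (f′ ⊛ g) n                      ∎
  where open ≡-Reasoning

⊛-distribʳ-⊕ : ∀ f g h → (f ⊕ g) ⊛ h ≗ (f ⊛ h) ⊕ (g ⊛ h)
⊛-distribʳ-⊕ f g h n = begin
  ((f ⊕ g) ⊛ h) n                                              ≡⟨ ⊛-as-sum (f ⊕ g) h n ⟩
  ∑[ i < suc n ] (f i + g i) * h (n ∸ i)                       ≡⟨ ∑-cong (suc n) (λ {i} _ → ℤ.*-distribʳ-+ (h (n ∸ i)) (f i) (g i)) ⟩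
  ∑[ i < suc n ] (f i * h (n ∸ i) + g i * h (n ∸ i))           ≡⟨ ∑-distrib-+ (λ i → f i * h (n ∸ i)) (λ i → g i * h (n ∸ i)) (suc n) ⟩
  ∑[ i < suc n ] f i * h (n ∸ i) + ∑[ i < suc n ] g i * h (n ∸ i) ≡⟨ cong₂ _+_ (⊛-as-sum f h n) (⊛-as-sum g h n) ⟨
  ((f ⊛ h) ⊕ (g ⊛ h)) n                                        ∎
  where open ≡-Reasoning

⊛-distribʳ-⊖ : ∀ f g h → (f ⊖ g) ⊛ h ≗ (f ⊛ h) ⊖ (g ⊛ h)
⊛-distribʳ-⊖ f g h n = begin
  ((f ⊖ g) ⊛ h) n                                              ≡⟨ ⊛-as-sum (f ⊖ g) h n ⟩
  ∑[ i < suc n ] (f i - g i) * h (n ∸ i)                       ≡⟨ ∑-cong (suc n) (λ {i} _ → distrib (f i) (g i) (h (n ∸ i))) ⟩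
  ∑[ i < suc n ] (f i * h (n ∸ i) - g i * h (n ∸ i))           ≡⟨ ∑-distrib-- (λ i → f i * h (n ∸ i)) (λ i → g i * h (n ∸ i)) (suc n) ⟩
  ∑[ i < suc n ] f i * h (n ∸ i) - ∑[ i < suc n ] g i * h (n ∸ i) ≡⟨ cong₂ _-_ (⊛-as-sum f h n) (⊛-as-sum g h n) ⟨
  ((f ⊛ h) ⊖ (g ⊛ h)) n                                        ∎
  where
  open ≡-Reasoning
  distrib : ∀ x y z → (x - y) * z ≡ x * z - y * z
  distrib = solve-∀

mono-⊛ : ∀ a g → mono a ⊛ g ≗ shift a g
mono-⊛ zero g n = begin
  (mono 0 ⊛ g) n                              ≡⟨ ⊛-as-sum (mono 0) g n ⟩
  1ℤ * g n + ∑[ i < n ] 0ℤ * g (n ∸ suc i)     ≡⟨ cong₂ _+_ (ℤ.*-identityˡ (g n)) (∑-zero n (λ i → ℤ.*-zeroˡ (g (n ∸ suc i)))) ⟩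
  g n + 0ℤ                                    ≡⟨ ℤ.+-identityʳ (g n) ⟩
  g n                                         ∎
  where open ≡-Reasoning
mono-⊛ (suc a) g zero    = refl
mono-⊛ (suc a) g (suc n) =
  trans (⊛-as-sum (mono (suc a)) g (suc n))
        (trans (ℤ.+-identityˡ _) (trans (sym (⊛-as-sum (mono a) g n)) (mono-⊛ a g n)))

shift-⊛ : ∀ a f g → shift a f ⊛ g ≗ shift a (f ⊛ g)
shift-⊛ zero    f g n       = refl
shift-⊛ (suc a) f g zero    = refl
shift-⊛ (suc a) f g (suc n) =
  trans (⊛-as-sum (shift (suc a) f) g (suc n))
        (trans (ℤ.+-identityˡ _) (trans (sym (⊛-as-sum (shift a f) g n)) (shift-⊛ a f g n)))

⊛-nonneg : ∀ {f g} → NonNeg f → NonNeg g → NonNeg (f ⊛ g)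
⊛-nonneg {f} {g} f≥0 g≥0 n =
  subst (0ℤ ≤ℤ_) (sym (⊛-as-sum f g n)) (∑-nonneg (suc n) (λ i → *-nonneg (f≥0 i) (g≥0 (n ∸ i))))
  where
  *-nonneg : ∀ {a b} → 0ℤ ≤ℤ a → 0ℤ ≤ℤ b → 0ℤ ≤ℤ a * b
  *-nonneg (+≤+ {n = m} _) (+≤+ {n = n} _) = subst (0ℤ ≤ℤ_) (ℤ.pos-* m n) (+≤+ z≤n)

geom-unfold : ∀ d → geom (suc d) ≗ one ⊕ shift (suc d) (geom (suc d))
geom-unfold d zero    = refl
geom-unfold d (suc n) with below-or-above (suc d) (suc n)
... | inj₁ n<d = begin
  geom (suc d) (suc n)                       ≡⟨ cong (λ b → if b then 1ℤ else 0ℤ) (dec-false (suc d ∣? suc n) (>⇒∤ n<d)) ⟩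
  0ℤ                                         ≡⟨ cong (0ℤ +_) (shift-below (suc d) (geom (suc d)) n<d) ⟨
  0ℤ + shift (suc d) (geom (suc d)) (suc n)  ∎
  where open ≡-Reasoning
... | inj₂ (y , refl) = begin
  geom (suc d) (suc d ℕ.+ y)                 ≡⟨ cong (λ b → if b then 1ℤ else 0ℤ) (does-⇔ d∣d+y⇔d∣y (suc d ∣? _) (suc d ∣? y)) ⟩
  geom (suc d) y                             ≡⟨ trans (ℤ.+-identityˡ _) (shift-above (suc d) (geom (suc d)) y) ⟨
  0ℤ + shift (suc d) (geom (suc d)) (suc d ℕ.+ y) ∎
  where
  open ≡-Reasoning
  d∣d+y⇔d∣y = mk⇔ (λ d∣d+y → ∣m+n∣m⇒∣n d∣d+y ∣-refl) (∣m∣n⇒∣m+n ∣-refl)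

invPoch2-suc : ∀ m → invPoch2 (suc m) ≗ invPoch2 m ⊕ shift (2 ℕ.+ m) (invPoch2 (suc m))
invPoch2-suc m n = begin
  (invPoch2 m ⊛ G) n                                ≡⟨ ⊛-comm (invPoch2 m) G n ⟩
  (G ⊛ invPoch2 m) n                                ≡⟨ ⊛-congˡ (invPoch2 m) (geom-unfold (suc m)) n ⟩
  ((one ⊕ shift (2 ℕ.+ m) G) ⊛ invPoch2 m) n        ≡⟨ ⊛-distribʳ-⊕ one (shift (2 ℕ.+ m) G) (invPoch2 m) n ⟩
  (one ⊛ invPoch2 m) n + (shift (2 ℕ.+ m) G ⊛ invPoch2 m) n
      ≡⟨ cong₂ _+_ (mono-⊛ 0 (invPoch2 m) n) (shift-⊛ (2 ℕ.+ m) G (invPoch2 m) n) ⟩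
  invPoch2 m n + shift (2 ℕ.+ m) (G ⊛ invPoch2 m) n ≡⟨ cong (invPoch2 m n +_) (shift-cong (2 ℕ.+ m) (⊛-comm G (invPoch2 m)) n) ⟩
  invPoch2 m n + shift (2 ℕ.+ m) (invPoch2 (suc m)) n ∎
  where
  open ≡-Reasoning
  G = geom (2 ℕ.+ m)

invPoch2-nonneg : ∀ m → NonNeg (invPoch2 m)
invPoch2-nonneg zero zero    = +≤+ z≤n
invPoch2-nonneg zero (suc n) = ℤ.≤-refl
invPoch2-nonneg (suc m)     = ⊛-nonneg (invPoch2-nonneg m) geom-nonneg
  where
  geom-nonneg : NonNeg (geom (2 ℕ.+ m))
  geom-nonneg n with does (2 ℕ.+ m ∣? n)
  ... | true  = +≤+ z≤n
  ... | false = ℤ.≤-refl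

shift-step : ∀ c d {f} x → NonNeg f → (∀ y → x ≡ c ℕ.+ y → f y ≤ℤ f (d ℕ.+ y)) →
             shift c f x ≤ℤ shift c f (d ℕ.+ x)
shift-step c d {f} x f≥0 f-step with below-or-above c x
... | inj₁ x<c = subst (_≤ℤ shift c f (d ℕ.+ x)) (sym (shift-below c f x<c)) (shift-nonneg c f≥0 (d ℕ.+ x))
... | inj₂ (y , refl) = begin
  shift c f (c ℕ.+ y)           ≡⟨ shift-above c f y ⟩
  f y                           ≤⟨ f-step y refl ⟩
  f (d ℕ.+ y)                   ≡⟨ shift-above c f (d ℕ.+ y) ⟨
  shift c f (c ℕ.+ (d ℕ.+ y))   ≡⟨ cong (shift c f) (+-left-comm c d y) ⟩
  shift c f (d ℕ.+ (c ℕ.+ y))   ∎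
  where open ℤ.≤-Reasoning

invPoch2-step : ∀ {d m} → 2 ≤ d → d ≤ suc m → ∀ x →
                invPoch2 m x + invPoch2 (d ∸ 2) (d ℕ.+ x) ≤ℤ invPoch2 m (d ℕ.+ x)
invPoch2-step {suc (suc d′)} {m} (s≤s (s≤s _)) (s≤s d′<m) x =
  subst (λ m → invPoch2 m x + invPoch2 d′ (d ℕ.+ x) ≤ℤ invPoch2 m (d ℕ.+ x))
        (ℕ.m∸n+n≡m d′<m) (<-rec P induct x (m ∸ suc d′))
  where
  d = 2 ℕ.+ d′
  P : ℕ → Set
  P x = ∀ e → invPoch2 (e ℕ.+ suc d′) x + invPoch2 d′ (d ℕ.+ x) ≤ℤ invPoch2 (e ℕ.+ suc d′) (d ℕ.+ x)
  induct : ∀ x → (∀ {y} → y < x → P y) → P x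
  induct x rec zero = ℤ.≤-reflexive (begin
    invPoch2 (suc d′) x + invPoch2 d′ (d ℕ.+ x)
      ≡⟨ ℤ.+-comm (invPoch2 (suc d′) x) (invPoch2 d′ (d ℕ.+ x)) ⟩
    invPoch2 d′ (d ℕ.+ x) + invPoch2 (suc d′) x
      ≡⟨ cong (invPoch2 d′ (d ℕ.+ x) +_) (shift-above d (invPoch2 (suc d′)) x) ⟨
    invPoch2 d′ (d ℕ.+ x) + shift d (invPoch2 (suc d′)) (d ℕ.+ x)
      ≡⟨ invPoch2-suc d′ (d ℕ.+ x) ⟨
    invPoch2 (suc d′) (d ℕ.+ x) ∎)
    where open ≡-Reasoning
  induct x rec (suc e) = begin
    Q M x + Q d′ (d ℕ.+ x)                         ≡⟨ cong (_+ Q d′ (d ℕ.+ x)) (invPoch2-suc m′ x) ⟩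
    Q m′ x + shift c (Q M) x + Q d′ (d ℕ.+ x)       ≡⟨ swap (Q m′ x) _ _ ⟩
    Q m′ x + Q d′ (d ℕ.+ x) + shift c (Q M) x       ≤⟨ ℤ.+-mono-≤ (induct x rec e) shift-c-step ⟩
    Q m′ (d ℕ.+ x) + shift c (Q M) (d ℕ.+ x)        ≡⟨ invPoch2-suc m′ (d ℕ.+ x) ⟨
    Q M (d ℕ.+ x)                                  ∎
    where
    open ℤ.≤-Reasoning
    Q = invPoch2
    m′ = e ℕ.+ suc d′
    M = suc m′
    c = 2 ℕ.+ m′
    swap : ∀ a b c → a + b + c ≡ a + c + b
    swap = solve-∀
    shift-c-step : shift c (Q M) x ≤ℤ shift c (Q M) (d ℕ.+ x)
    shift-c-step = shift-step c d x (invPoch2-nonneg M) λ y x≡c+y →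
      ℤ.≤-trans (ℤ.i≤i+j _ _ ⦃ nonNegative (invPoch2-nonneg d′ (d ℕ.+ y)) ⦄)
                (rec (subst (y <_) (sym x≡c+y) (ℕ.m<n+m y z<s)) (suc e))

invPoch2-mono-step : ∀ {d m} → 2 ≤ d → d ≤ suc m → ∀ x → invPoch2 m x ≤ℤ invPoch2 m (d ℕ.+ x)
invPoch2-mono-step {d} 2≤d d≤1+m x =
  ℤ.≤-trans (ℤ.i≤i+j _ _ ⦃ nonNegative (invPoch2-nonneg (d ∸ 2) (d ℕ.+ x)) ⦄) (invPoch2-step 2≤d d≤1+m x)

invPoch2-mono : ∀ {m} c → 2 ≤ m → c ≢ 1 → ∀ x → invPoch2 m x ≤ℤ invPoch2 m (c ℕ.+ x)
invPoch2-mono 0 2≤m c≢1 x = ℤ.≤-refl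
invPoch2-mono 1 2≤m c≢1 x = contradiction refl c≢1
invPoch2-mono 2 2≤m c≢1 x = invPoch2-mono-step ℕ.≤-refl (ℕ.m≤n⇒m≤1+n 2≤m) x
invPoch2-mono 3 2≤m c≢1 x = invPoch2-mono-step (ℕ.m≤n⇒m≤1+n ℕ.≤-refl) (s≤s 2≤m) x
invPoch2-mono (suc (suc (suc (suc c)))) 2≤m c≢1 x =
  ℤ.≤-trans (invPoch2-mono (suc (suc c)) 2≤m (λ ()) x) (invPoch2-mono 2 2≤m (λ ()) (2 ℕ.+ c ℕ.+ x))

invPoch2-monoˡ : ∀ {m n} → m ≤ n → ∀ x → invPoch2 m x ≤ℤ invPoch2 n x
invPoch2-monoˡ {m} {n} m≤n x =
  subst (λ n → invPoch2 m x ≤ℤ invPoch2 n x) (ℕ.m∸n+n≡m m≤n) (add-parts (n ∸ m))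
  where
  add-parts : ∀ k → invPoch2 m x ≤ℤ invPoch2 (k ℕ.+ m) x
  add-parts zero    = ℤ.≤-refl
  add-parts (suc k) = ℤ.≤-trans (add-parts k)
    (subst (invPoch2 (k ℕ.+ m) x ≤ℤ_) (sym (invPoch2-suc (k ℕ.+ m) x))
           (ℤ.i≤i+j _ _ ⦃ nonNegative (shift-nonneg (2 ℕ.+ (k ℕ.+ m)) (invPoch2-nonneg (suc (k ℕ.+ m))) x) ⦄))

invPoch2-pos : ∀ {m} → 2 ≤ m → ∀ x → 1ℤ ≤ℤ invPoch2 m (2 ℕ.+ x)
invPoch2-pos 2≤m x = ℤ.≤-trans (invPoch2-2-pos x) (invPoch2-monoˡ 2≤m (2 ℕ.+ x))
  where
  invPoch2-2-pos : ∀ x → 1ℤ ≤ℤ invPoch2 2 (2 ℕ.+ x)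
  invPoch2-2-pos 0 = ℤ.≤-refl
  invPoch2-2-pos 1 = ℤ.≤-refl
  invPoch2-2-pos (suc (suc x)) = ℤ.≤-trans (invPoch2-2-pos x) (invPoch2-mono 2 ℕ.≤-refl (λ ()) (2 ℕ.+ x))

invPoch2-gap : ∀ {m} c → 3 ≤ m → c ≢ 1 → ∀ y → 1ℤ + invPoch2 m y ≤ℤ invPoch2 m (4 ℕ.+ c ℕ.+ y)
invPoch2-gap {m} c 3≤m c≢1 y = begin
  1ℤ + invPoch2 m y                             ≡⟨ ℤ.+-comm 1ℤ (invPoch2 m y) ⟩
  invPoch2 m y + 1ℤ                             ≤⟨ ℤ.+-mono-≤ (invPoch2-mono c 2≤m c≢1 y) (invPoch2-pos ℕ.≤-refl (2 ℕ.+ c ℕ.+ y)) ⟩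
  invPoch2 m (c ℕ.+ y) + invPoch2 2 (4 ℕ.+ c ℕ.+ y) ≤⟨ invPoch2-step (s≤s (s≤s z≤n)) (s≤s 3≤m) (c ℕ.+ y) ⟩
  invPoch2 m (4 ℕ.+ c ℕ.+ y)                    ∎
  where
  open ℤ.≤-Reasoning
  2≤m = ℕ.≤-trans (s≤s (s≤s z≤n)) 3≤m

invPoch2-1-period : ∀ x → invPoch2 1 (2 ℕ.+ x) ≡ invPoch2 1 x
invPoch2-1-period x = trans (invPoch2-suc 0 (2 ℕ.+ x)) (ℤ.+-identityˡ (invPoch2 1 x))

invPoch2-1-periodic : ∀ r x → invPoch2 1 (r ℕ.* 2 ℕ.+ x) ≡ invPoch2 1 x
invPoch2-1-periodic zero    x = refl
invPoch2-1-periodic (suc r) x = trans (invPoch2-1-period (r ℕ.* 2 ℕ.+ x)) (invPoch2-1-periodic r x)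

invPoch2-1-≤1 : ∀ x → invPoch2 1 x ≤ℤ 1ℤ
invPoch2-1-≤1 0             = ℤ.≤-refl
invPoch2-1-≤1 1             = +≤+ z≤n
invPoch2-1-≤1 (suc (suc x)) = subst (_≤ℤ 1ℤ) (sym (invPoch2-1-period x)) (invPoch2-1-≤1 x)

-- Every n ≥ 6 is a sum of 3s and 4s, and every n ≥ 3 one of 3s, 4s and 5s.
invPoch2-3-gap : ∀ x → 1ℤ + invPoch2 3 (4 ℕ.+ x) ≤ℤ invPoch2 3 (6 ℕ.+ x)
invPoch2-3-gap 0 = ℤ.≤ᵇ⇒≤ tt
invPoch2-3-gap 1 = ℤ.≤ᵇ⇒≤ tt
invPoch2-3-gap 2 = ℤ.≤ᵇ⇒≤ tt
invPoch2-3-gap 3 = ℤ.≤ᵇ⇒≤ tt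
invPoch2-3-gap (suc (suc (suc (suc x)))) = begin
  1ℤ + invPoch2 3 (8 ℕ.+ x)                     ≡⟨ cong (1ℤ +_) (invPoch2-suc 2 (8 ℕ.+ x)) ⟩
  1ℤ + (invPoch2 2 (8 ℕ.+ x) + invPoch2 3 (4 ℕ.+ x)) ≡⟨ left-comm 1ℤ (invPoch2 2 (8 ℕ.+ x)) _ ⟩
  invPoch2 2 (8 ℕ.+ x) + (1ℤ + invPoch2 3 (4 ℕ.+ x)) ≤⟨ ℤ.+-mono-≤ (invPoch2-mono 2 ℕ.≤-refl (λ ()) (8 ℕ.+ x)) (invPoch2-3-gap x) ⟩
  invPoch2 2 (10 ℕ.+ x) + invPoch2 3 (6 ℕ.+ x)  ≡⟨ invPoch2-suc 2 (10 ℕ.+ x) ⟨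
  invPoch2 3 (10 ℕ.+ x)                         ∎
  where
  open ℤ.≤-Reasoning
  left-comm : ∀ a b c → a + (b + c) ≡ b + (a + c)
  left-comm = solve-∀

invPoch2-4-gap : ∀ x → 1ℤ + invPoch2 4 (1 ℕ.+ x) ≤ℤ invPoch2 4 (3 ℕ.+ x)
invPoch2-4-gap 0 = ℤ.≤ᵇ⇒≤ tt
invPoch2-4-gap 1 = ℤ.≤ᵇ⇒≤ tt
invPoch2-4-gap 2 = ℤ.≤ᵇ⇒≤ tt
invPoch2-4-gap (suc (suc (suc x))) = begin
  1ℤ + invPoch2 4 (4 ℕ.+ x)                                ≡⟨ cong (1ℤ +_) (invPoch2-suc 3 (4 ℕ.+ x)) ⟩
  1ℤ + (invPoch2 3 (4 ℕ.+ x) + shift 5 (invPoch2 4) (4 ℕ.+ x)) ≡⟨ ℤ.+-assoc 1ℤ (invPoch2 3 (4 ℕ.+ x)) (shift 5 (invPoch2 4) (4 ℕ.+ x)) ⟨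
  1ℤ + invPoch2 3 (4 ℕ.+ x) + shift 5 (invPoch2 4) (4 ℕ.+ x)   ≤⟨ ℤ.+-mono-≤ (invPoch2-3-gap x) shift-5-step ⟩
  invPoch2 3 (6 ℕ.+ x) + shift 5 (invPoch2 4) (6 ℕ.+ x)    ≡⟨ invPoch2-suc 3 (6 ℕ.+ x) ⟨
  invPoch2 4 (6 ℕ.+ x)                                     ∎
  where
  open ℤ.≤-Reasoning
  shift-5-step : shift 5 (invPoch2 4) (4 ℕ.+ x) ≤ℤ shift 5 (invPoch2 4) (6 ℕ.+ x)
  shift-5-step = shift-step 5 2 (4 ℕ.+ x) (invPoch2-nonneg 4) (λ y _ → invPoch2-mono {4} 2 (s≤s (s≤s z≤n)) (λ ()) y)

diffPoch2 : ℕ → ℕ → Series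
diffPoch2 m c = invPoch2 m ⊖ shift c (invPoch2 m)

diffPoch2-lower : ∀ {b} m c n → (n < c → b ≤ℤ invPoch2 m n) →
                  (∀ y → n ≡ c ℕ.+ y → b + invPoch2 m y ≤ℤ invPoch2 m n) → b ≤ℤ diffPoch2 m c n
diffPoch2-lower {b} m c n below above with below-or-above c n
... | inj₁ n<c = subst (λ s → b ≤ℤ invPoch2 m n - s) (sym (shift-below c (invPoch2 m) n<c))
                       (subst (b ≤ℤ_) (sym (ℤ.+-identityʳ (invPoch2 m n))) (below n<c))
... | inj₂ (y , refl) = subst (λ s → b ≤ℤ invPoch2 m (c ℕ.+ y) - s) (sym (shift-above c (invPoch2 m) y))
                              (i+j≤k⇒i≤k-j (above y refl))

diffPoch2-nonneg : ∀ {m c} → 2 ≤ m → 2 ≤ c → NonNeg (diffPoch2 m c)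
diffPoch2-nonneg {m} {c} 2≤m 2≤c n = diffPoch2-lower m c n (λ _ → invPoch2-nonneg m n) λ { y refl →
  subst (_≤ℤ invPoch2 m (c ℕ.+ y)) (sym (ℤ.+-identityˡ (invPoch2 m y))) (invPoch2-mono c 2≤m (ℕ.>⇒≢ 2≤c) y) }

diffPoch2-below : ∀ m {c n} → n < c → 0ℤ ≤ℤ diffPoch2 m c n
diffPoch2-below m {c} {n} n<c = diffPoch2-lower m c n (λ _ → invPoch2-nonneg m n) λ { y refl →
  contradiction (ℕ.≤-trans n<c (ℕ.m≤m+n c y)) (ℕ.n≮n (c ℕ.+ y)) }

diffPoch2-pos : ∀ {m c} → 3 ≤ m → 4 ≤ c → c ≢ 5 → ∀ x → 1ℤ ≤ℤ diffPoch2 m c (2 ℕ.+ x)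
diffPoch2-pos {m} {c} 3≤m (s≤s (s≤s (s≤s (s≤s _)))) c≢5 x = diffPoch2-lower m c (2 ℕ.+ x)
  (λ _ → invPoch2-pos (ℕ.≤-trans (s≤s (s≤s z≤n)) 3≤m) x)
  (λ { y refl → invPoch2-gap _ 3≤m (c≢5 ∘ cong (4 ℕ.+_)) y })

diffPoch2-1-≥-1 : ∀ c n → -1ℤ ≤ℤ diffPoch2 1 c n
diffPoch2-1-≥-1 c n = ℤ.+-mono-≤ (invPoch2-nonneg 1 n)
  (ℤ.neg-mono-≤ (shift-elim (_≤ℤ 1ℤ) c (invPoch2 1) (+≤+ z≤n) invPoch2-1-≤1 n))

diffPoch2-1-even : ∀ r → NonNeg (diffPoch2 1 (r ℕ.* 2))
diffPoch2-1-even r n = diffPoch2-lower 1 (r ℕ.* 2) n (λ _ → invPoch2-nonneg 1 n) λ { y refl →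
  ℤ.≤-reflexive (trans (ℤ.+-identityˡ (invPoch2 1 y)) (sym (invPoch2-1-periodic r y))) }

diffPoch2-3-2-pos : ∀ x → 1ℤ ≤ℤ diffPoch2 3 2 (6 ℕ.+ x)
diffPoch2-3-2-pos x = i+j≤k⇒i≤k-j (invPoch2-3-gap x)

diffPoch2-4-2-pos : ∀ x → 1ℤ ≤ℤ diffPoch2 4 2 (3 ℕ.+ x)
diffPoch2-4-2-pos x = i+j≤k⇒i≤k-j (invPoch2-4-gap x)

diffPoch2-3-5-pos : ∀ x → 1ℤ ≤ℤ diffPoch2 3 5 (7 ℕ.+ x)
diffPoch2-3-5-pos x = i+j≤k⇒i≤k-j (ℤ.≤-trans
  (ℤ.+-monoʳ-≤ 1ℤ (invPoch2-mono {3} 3 (s≤s (s≤s z≤n)) (λ ()) (2 ℕ.+ x))) (invPoch2-3-gap (1 ℕ.+ x)))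

summand-shift : ∀ k j → summand k j ≗ shift (2 ℕ.* j) (diffPoch2 (j ∸ 1) (k ∸ j ℕ.+ 2))
summand-shift k j n = begin
  ((mono a ⊖ mono (a ℕ.+ c)) ⊛ G) n                ≡⟨ ⊛-distribʳ-⊖ (mono a) (mono (a ℕ.+ c)) G n ⟩
  (mono a ⊛ G) n - (mono (a ℕ.+ c) ⊛ G) n          ≡⟨ cong₂ _-_ (mono-⊛ a G n) (trans (mono-⊛ (a ℕ.+ c) G n) (shift-+ a c G n)) ⟩
  shift a G n - shift a (shift c G) n              ≡⟨ shift-⊖ a G (shift c G) n ⟩
  shift a (diffPoch2 (j ∸ 1) c) n                  ∎
  where
  open ≡-Reasoning
  a = 2 ℕ.* j
  c = k ∸ j ℕ.+ 2
  G = invPoch2 (j ∸ 1)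

summand-≥ : ∀ {b} k j → b ≤ℤ 0ℤ → (∀ x → b ≤ℤ diffPoch2 (j ∸ 1) (k ∸ j ℕ.+ 2) x) → ∀ n → b ≤ℤ summand k j n
summand-≥ {b} k j b≤0 b≤diff n =
  subst (b ≤ℤ_) (sym (summand-shift k j n)) (shift-elim (b ≤ℤ_) (2 ℕ.* j) _ b≤0 b≤diff n)

summand-pos : ∀ k j x → 1ℤ ≤ℤ diffPoch2 (j ∸ 1) (k ∸ j ℕ.+ 2) x → 1ℤ ≤ℤ summand k j (2 ℕ.* j ℕ.+ x)
summand-pos k j x = subst (1ℤ ≤ℤ_) (sym (trans (summand-shift k j _) (shift-above (2 ℕ.* j) _ x)))

summand-nonneg : ∀ k j → 3 ≤ j → ∀ n → 0ℤ ≤ℤ summand k j n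
summand-nonneg k (suc j) (s≤s 2≤j) = summand-≥ k (suc j) ℤ.≤-refl (diffPoch2-nonneg 2≤j (ℕ.m≤n+m 2 (k ∸ suc j)))

summand-2-≥-1 : ∀ k n → -1ℤ ≤ℤ summand k 2 n
summand-2-≥-1 k = summand-≥ k 2 -≤+ (diffPoch2-1-≥-1 (k ∸ 2 ℕ.+ 2))

summand-2-nonneg-below : ∀ k {n} → 2 ≤ k → n < k ℕ.+ 4 → 0ℤ ≤ℤ summand k 2 n
summand-2-nonneg-below k {n} 2≤k n<k+4 with below-or-above 4 n
... | inj₁ n<4 = ℤ.≤-reflexive (sym (trans (summand-shift k 2 n) (shift-below 4 _ n<4)))
... | inj₂ (x , refl) = subst (0ℤ ≤ℤ_) (sym (summand-shift k 2 (4 ℕ.+ x))) (diffPoch2-below 1 x<k∸2+2)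
  where
  x<k∸2+2 : x < k ∸ 2 ℕ.+ 2
  x<k∸2+2 = subst (x <_) (sym (ℕ.m∸n+n≡m 2≤k))
                  (ℕ.+-cancelˡ-< 4 x k (subst (4 ℕ.+ x <_) (ℕ.+-comm k 4) n<k+4))

3≤3+n : ∀ {n} → 3 ≤ 3 ℕ.+ n
3≤3+n = s≤s (s≤s (s≤s z≤n))

t-unfold : ∀ k′ n → let k = 4 ℕ.+ k′ in
           t k n ≡ summand k 2 n + (summand k 3 n + (summand k 4 n + ∑[ i < k′ ] summand k (5 ℕ.+ i) n))
t-unfold k′ n = cong (λ s → summand k 2 n + (summand k 3 n + (summand k 4 n + s)))
                     (sumℤ-map-applyUpTo (λ i → summand k (2 ℕ.+ i) n) (λ i → 3 ℕ.+ i) k′)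
  where k = 4 ℕ.+ k′

tail-nonneg : ∀ k j₀ → 3 ≤ j₀ → ∀ l n → 0ℤ ≤ℤ ∑[ i < l ] summand k (j₀ ℕ.+ i) n
tail-nonneg k j₀ 3≤j₀ l n =
  ∑-nonneg l (λ i → summand-nonneg k (j₀ ℕ.+ i) (ℕ.≤-trans 3≤j₀ (ℕ.m≤m+n j₀ i)) n)

t-nonneg-of-summand-2 : ∀ k′ n → 0ℤ ≤ℤ summand (4 ℕ.+ k′) 2 n → 0ℤ ≤ℤ t (4 ℕ.+ k′) n
t-nonneg-of-summand-2 k′ n s₂≥0 = subst (0ℤ ≤ℤ_) (sym (t-unfold k′ n))
  (ℤ.+-mono-≤ s₂≥0 (ℤ.+-mono-≤ (summand-nonneg k 3 3≤3+n n)
    (ℤ.+-mono-≤ (summand-nonneg k 4 3≤3+n n) (tail-nonneg k 5 3≤3+n k′ n))))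
  where k = 4 ℕ.+ k′

t-pos-of-summand-4 : ∀ k′ n → 0ℤ ≤ℤ summand (4 ℕ.+ k′) 2 n → 1ℤ ≤ℤ summand (4 ℕ.+ k′) 4 n →
                     1ℤ ≤ℤ t (4 ℕ.+ k′) n
t-pos-of-summand-4 k′ n s₂≥0 s₄≥1 = subst (1ℤ ≤ℤ_) (sym (t-unfold k′ n))
  (ℤ.+-mono-≤ s₂≥0 (ℤ.+-mono-≤ (summand-nonneg k 3 3≤3+n n) (ℤ.+-mono-≤ s₄≥1 (tail-nonneg k 5 3≤3+n k′ n))))
  where k = 4 ℕ.+ k′

t-pos-of-summands-4-5 : ∀ k″ n → 1ℤ ≤ℤ summand (5 ℕ.+ k″) 4 n → 1ℤ ≤ℤ summand (5 ℕ.+ k″) 5 n →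
                        1ℤ ≤ℤ t (5 ℕ.+ k″) n
t-pos-of-summands-4-5 k″ n s₄≥1 s₅≥1 = subst (1ℤ ≤ℤ_) (sym (t-unfold (suc k″) n))
  (ℤ.+-mono-≤ (summand-2-≥-1 k n) (ℤ.+-mono-≤ (summand-nonneg k 3 3≤3+n n)
    (ℤ.+-mono-≤ s₄≥1 (ℤ.+-mono-≤ s₅≥1 (tail-nonneg k 6 3≤3+n k″ n)))))
  where k = 5 ℕ.+ k″

t-nonneg-of-summand-5 : ∀ k″ n → 1ℤ ≤ℤ summand (5 ℕ.+ k″) 5 n → 0ℤ ≤ℤ t (5 ℕ.+ k″) n
t-nonneg-of-summand-5 k″ n s₅≥1 = subst (0ℤ ≤ℤ_) (sym (t-unfold (suc k″) n))
  (ℤ.+-mono-≤ (summand-2-≥-1 k n) (ℤ.+-mono-≤ (summand-nonneg k 3 3≤3+n n)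
    (ℤ.+-mono-≤ (summand-nonneg k 4 3≤3+n n) (ℤ.+-mono-≤ s₅≥1 (tail-nonneg k 6 3≤3+n k″ n)))))
  where k = 5 ℕ.+ k″

check-below : ∀ {P : ℕ → Set} (P? : Decidable P) N → {True (all? {n = N} (P? ∘ toℕ))} →
              ∀ n → n < N → P n
check-below {P} P? N {checked} n n<N = subst P (toℕ-fromℕ< n<N) (toWitness checked (fromℕ< n<N))

above-threshold : ∀ {P : ℕ → Set} N → (∀ w → P (N ℕ.+ w)) → ∀ n → N ≤ n → P n
above-threshold {P} N above n N≤n = subst P (ℕ.m+[n∸m]≡n N≤n) (above (n ∸ N))

split-at : ∀ {P : ℕ → Set} N → (∀ n → n < N → P n) → (∀ w → P (N ℕ.+ w)) → ∀ n → P n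
split-at {P} N below above n with n <? N
... | yes n<N = below n n<N
... | no  n≮N = above-threshold {P} N above n (ℕ.≮⇒≥ n≮N)

t-large-pos : ∀ k″ n → 13 ≤ n → 1ℤ ≤ℤ t (9 ℕ.+ k″) n
t-large-pos k″ = above-threshold 13 λ w → t-pos-of-summands-4-5 (4 ℕ.+ k″) (13 ℕ.+ w)
  (summand-pos k 4 (5 ℕ.+ w) (diffPoch2-pos {3} 3≤3+n (4≤ 6≤k-2) (ℕ.>⇒≢ 6≤k-2) (3 ℕ.+ w)))
  (summand-pos k 5 (3 ℕ.+ w) (diffPoch2-pos {4} 3≤3+n (4≤ 6≤k-3) (ℕ.>⇒≢ 6≤k-3) (1 ℕ.+ w)))
  where
  k = 9 ℕ.+ k″
  6≤k-3 : 6 ≤ 4 ℕ.+ k″ ℕ.+ 2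
  6≤k-3 = s≤s (s≤s (s≤s (s≤s (ℕ.m≤n+m 2 k″))))
  6≤k-2 : 6 ≤ 5 ℕ.+ k″ ℕ.+ 2
  6≤k-2 = ℕ.m≤n⇒m≤1+n 6≤k-3
  4≤ : ∀ {c} → 6 ≤ c → 4 ≤ c
  4≤ = ℕ.≤-trans (ℕ.m≤m+n 4 2)

t-7-pos : ∀ w → 1ℤ ≤ℤ t 7 (15 ℕ.+ w)
t-7-pos w = t-pos-of-summands-4-5 2 (15 ℕ.+ w)
  (summand-pos 7 4 (7 ℕ.+ w) (diffPoch2-3-5-pos w))
  (summand-pos 7 5 (5 ℕ.+ w) (diffPoch2-pos {4} 3≤3+n ℕ.≤-refl (λ ()) (3 ℕ.+ w)))

t-nonneg : ∀ k′ n → 0ℤ ≤ℤ t (4 ℕ.+ k′) n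
t-nonneg 0 n = t-nonneg-of-summand-2 0 n (summand-≥ 4 2 ℤ.≤-refl (diffPoch2-1-even 2) n)
t-nonneg 1 = split-at 13 (check-below (λ n → 0ℤ ≤? t 5 n) 13) λ w →
  t-nonneg-of-summand-5 0 (13 ℕ.+ w) (summand-pos 5 5 (3 ℕ.+ w) (diffPoch2-4-2-pos w))
t-nonneg 2 n = t-nonneg-of-summand-2 2 n (summand-≥ 6 2 ℤ.≤-refl (diffPoch2-1-even 3) n)
t-nonneg 3 = split-at 15 (check-below (λ n → 0ℤ ≤? t 7 n) 15) λ w → ℤ.≤-trans (+≤+ z≤n) (t-7-pos w)
t-nonneg 4 n = t-nonneg-of-summand-2 4 n (summand-≥ 8 2 ℤ.≤-refl (diffPoch2-1-even 4) n)
t-nonneg k′@(suc (suc (suc (suc (suc k″))))) = split-at (k ℕ.+ 4)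
  (λ n n<k+4 → t-nonneg-of-summand-2 k′ n (summand-2-nonneg-below k (s≤s (s≤s z≤n)) n<k+4))
  (λ w → ℤ.≤-trans (+≤+ z≤n) (t-large-pos k″ (k ℕ.+ 4 ℕ.+ w)
    (ℕ.≤-trans (ℕ.+-monoˡ-≤ 4 (ℕ.m≤m+n 9 k″)) (ℕ.m≤m+n (k ℕ.+ 4) w))))
  where k = 4 ℕ.+ k′

t-pos-from-14 : ∀ k′ → 4 ℕ.+ k′ ≢ 5 → ∀ w → 1ℤ ≤ℤ t (4 ℕ.+ k′) (14 ℕ.+ w)
t-pos-from-14 0 _ w = t-pos-of-summand-4 0 (14 ℕ.+ w)
  (summand-≥ 4 2 ℤ.≤-refl (diffPoch2-1-even 2) (14 ℕ.+ w))
  (summand-pos 4 4 (6 ℕ.+ w) (diffPoch2-3-2-pos w))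
t-pos-from-14 1 k≢5 w = contradiction refl k≢5
t-pos-from-14 2 _ w = t-pos-of-summand-4 2 (14 ℕ.+ w)
  (summand-≥ 6 2 ℤ.≤-refl (diffPoch2-1-even 3) (14 ℕ.+ w))
  (summand-pos 6 4 (6 ℕ.+ w) (diffPoch2-pos {3} 3≤3+n ℕ.≤-refl (λ ()) (4 ℕ.+ w)))
t-pos-from-14 3 _ zero    = ℤ.≤ᵇ⇒≤ tt
t-pos-from-14 3 _ (suc w) = t-7-pos w
t-pos-from-14 4 _ w = t-pos-of-summand-4 4 (14 ℕ.+ w)
  (summand-≥ 8 2 ℤ.≤-refl (diffPoch2-1-even 4) (14 ℕ.+ w))
  (summand-pos 8 4 (6 ℕ.+ w) (diffPoch2-pos {3} 3≤3+n (ℕ.m≤m+n 4 2) (λ ()) (4 ℕ.+ w)))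
t-pos-from-14 (suc (suc (suc (suc (suc k″))))) _ w = t-large-pos k″ (14 ℕ.+ w) (ℕ.m≤m+n 13 (suc w))

lemma2p3 : (k : ℕ) → 4 ≤ k →
    ((n : ℕ) → 0ℤ ≤ℤ t k n) × (k ≢ 5 → (n : ℕ) → 14 ≤ n → 1ℤ ≤ℤ t k n)
lemma2p3 k (s≤s (s≤s (s≤s (s≤s {n = k′} _)))) =
  t-nonneg k′ , λ k≢5 → above-threshold 14 (t-pos-from-14 k′ k≢5)
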